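{- Let $r\ge1$, $\delta\ge2$, $e\ge1$, $a\ge1$ be integers, and let $G$ be an $r$-uniform hypergraph with $e$ edges. Suppose $a\le(r-1)(\delta-1)+1$ and $e\le\binom{r+\delta-1}{r}-a$. Then $f_{r,\delta}(G)\ge a$.
   Context: For an $r$-uniform hypergraph $G$ and $0\le m\le r$, the $m$-shadow $\partial_m(G)$ is the set of $m$-element sets contained in some edge of $G$ (so $\partial_0(G)=\{\emptyset\}$ when $G$ has an edge). For integers $r,\delta\ge1$, $f_{r,\delta}(G)=\delta\,|\partial_{r-1}(G)|-r\,|E(G)|$. -}

module Defs where

open import Data.Nat using (ℕ; zero; suc; _∸_; _≟_)
open import Data.Bool using (Bool; true; false)
open import Data.Vec using (_∷_; [])
open import Data.List using (List; []; _∷_; length; filter; map; _++_)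
open import Data.List.Relation.Unary.Any using (Any)
import Data.List.Relation.Unary.Any as Any
open import Data.List.Relation.Unary.All using (All)
open import Data.List.Relation.Unary.Unique.Propositional using (Unique)
open import Data.Fin.Subset using (Subset; _⊆_; ∣_∣)
open import Data.Fin.Subset.Properties using (_⊆?_)
open import Data.Integer using (ℤ; +_; _-_)
open import Data.Product using (_×_)
open import Relation.Binary.PropositionalEquality using (_≡_)
open import Relation.Nullary.Decidable using (_×-dec_)

record Hypergraph (r : ℕ) : Set where
  field
    n       : ℕ
    edges   : List (Subset n)
    unique  : Unique edges
    uniform : All (λ E → ∣ E ∣ ≡ r) edges
open Hypergraph public

numEdges : ∀ {r} → Hypergraph r → ℕ
numEdges G = length (edges G)

allSubsets : (n : ℕ) → List (Subset n)
allSubsets zero = [] ∷ []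
allSubsets (suc n) = map (false ∷_) (allSubsets n) ++ map (true ∷_) (allSubsets n)

shadow : ∀ {r} → ℕ → (G : Hypergraph r) → List (Subset (n G))
shadow m G = filter (λ S → (∣ S ∣ ≟ m) ×-dec Any.any? (λ E → S ⊆? E) (edges G))
                    (allSubsets (n G))

shadowSize : ∀ {r} → ℕ → Hypergraph r → ℕ
shadowSize m G = length (shadow m G)

f : (r δ : ℕ) → Hypergraph r → ℤ
f r δ G = + (δ Data.Nat.* shadowSize (r ∸ 1) G) - + (r Data.Nat.* numEdges G)

{-# OPTIONS --safe #-}
-- Write r = p + 1 and δ = d + 2. The points (C(x, r), C(x, p)), x ≥ p, span a concave polygon
-- F_p whose segment over [C(x, r), C(x + 1, r)], x = k + p, has slope p/(k + 1). Splitting the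
-- edges at a vertex into its link L and the deletion R gives |∂G| ≥ |∂L| + max(|L|, |∂R|), and
-- the polygons satisfy F_{p+1}(l + m) ≤ F_p(l) + max(l, F_{p+1}(m)); so by induction on the
-- number of vertices the (r−1)-shadow of G has at least F_p(e) elements. Then δ F_p(e) − r e is
-- affine on each segment; at the vertex x = j + p it equals (δ − j) C(j + p, p), which is at
-- least (δ − j)(1 + p j) ≥ p(δ − 1) + 1 ≥ a for 1 ≤ j ≤ δ − 1, and on the last segment the
-- hypothesis e + a ≤ C(r + δ − 1, r) bounds it below by a directly.
module Submission where

open import Defs
open import Data.Nat
open import Data.Nat.Properties
open import Data.Nat.Combinatorics using (_C_; nCn≡1; nC1≡n; k>n⇒nCk≡0; nCk+nC[k+1]≡[n+1]C[k+1])
open import Data.Nat.Tactic.RingSolver using (solve-∀)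
open import Data.Bool using (true; false; if_then_else_)
open import Data.Vec using ([]; _∷_)
open import Data.List using (List; []; _∷_; length; filter; map; _++_)
open import Data.List.Properties using (filter-++; length-++)
open import Data.List.Relation.Unary.Any using (Any; here; there)
import Data.List.Relation.Unary.Any as Any
open import Data.List.Relation.Unary.All using (All; []; _∷_)
import Data.List.Relation.Unary.All as All
open import Data.List.Relation.Unary.AllPairs using ([]; _∷_)
open import Data.List.Relation.Unary.Unique.Propositional using (Unique)
open import Data.Fin.Subset using (Subset; _⊆_; ∣_∣; inside; outside; ⊥)
open import Data.Fin.Subset.Properties using (_⊆?_; ⊥⊆; ∣⊥∣≡0; ⊆-reflexive; in⊆in; out⊆)
open import Data.Product using (∃₂; _×_; _,_)
open import Data.Sum using (inj₁; inj₂)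
open import Data.Empty using (⊥-elim)
open import Relation.Binary.PropositionalEquality
open import Relation.Nullary using (yes; no; does; ¬_)
open import Relation.Nullary.Decidable using (_×-dec_)
open import Relation.Unary using (Decidable)

-- Pascal's rule holds by computation for binom, unlike for _C_ (see binom≡C).
binom : ℕ → ℕ → ℕ
binom _       zero    = 1
binom zero    (suc k) = 0
binom (suc n) (suc k) = binom n k + binom n (suc k)

binom≡C : ∀ n k → binom n k ≡ n C k
binom≡C n       zero    = refl
binom≡C zero    (suc k) = refl
binom≡C (suc n) (suc k) =
  trans (cong₂ _+_ (binom≡C n k) (binom≡C n (suc k))) (nCk+nC[k+1]≡[n+1]C[k+1] n k)

binom-diag : ∀ n → binom n n ≡ 1
binom-diag n = trans (binom≡C n n) (nCn≡1 n)

binom-over-diag : ∀ n → binom n (suc n) ≡ 0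
binom-over-diag n = trans (binom≡C n (suc n)) (k>n⇒nCk≡0 (n<1+n n))

binom-pos : ∀ {n k} → k ≤ n → 1 ≤ binom n k
binom-pos {k = zero}    _         = ≤-refl
binom-pos {suc n} {suc k} (s≤s k≤n) = ≤-trans (binom-pos k≤n) (m≤m+n _ _)

binom-one : ∀ n → binom n 1 ≡ n
binom-one n = trans (binom≡C n 1) (nC1≡n n)

binom-absorb : ∀ n k → suc k * binom (suc n) (suc k) ≡ suc n * binom n k
binom-absorb n       zero    = trans (+-identityʳ _) (trans (binom-one (suc n)) (sym (*-identityʳ _)))
binom-absorb zero    (suc k) = *-zeroʳ (2 + k)
binom-absorb (suc n) (suc k) = begin
  suc (suc k) * (b + binom (suc n) (suc (suc k)))
    ≡⟨ *-distribˡ-+ (suc (suc k)) b _ ⟩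
  suc (suc k) * b + suc (suc k) * binom (suc n) (suc (suc k))
    ≡⟨ cong (suc (suc k) * b +_) (binom-absorb n (suc k)) ⟩
  (b + suc k * b) + suc n * binom n (suc k)
    ≡⟨ cong (λ c → (b + c) + suc n * binom n (suc k)) (binom-absorb n k) ⟩
  (b + suc n * binom n k) + suc n * binom n (suc k)
    ≡⟨ +-assoc b _ _ ⟩
  b + (suc n * binom n k + suc n * binom n (suc k))
    ≡⟨ cong (b +_) (sym (*-distribˡ-+ (suc n) (binom n k) _)) ⟩
  suc (suc n) * b
    ∎
  where
  open ≡-Reasoning
  b = binom (suc n) (suc k)

binom-index-ratio : ∀ {x} k p → k + p ≡ x → suc p * binom x (suc p) ≡ k * binom x p
binom-index-ratio k p refl = +-cancelˡ-≡ (suc p * c) _ _ (begin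
  suc p * c + suc p * binom x (suc p) ≡⟨ *-distribˡ-+ (suc p) c _ ⟨
  suc p * binom (suc x) (suc p)       ≡⟨ binom-absorb x p ⟩
  suc (k + p) * c                     ≡⟨ cong (_* c) (cong suc (+-comm k p)) ⟩
  (suc p + k) * c                     ≡⟨ *-distribʳ-+ c (suc p) k ⟩
  suc p * c + k * c                   ∎)
  where
  open ≡-Reasoning
  x = k + p
  c = binom x p

binom-row-ratio : ∀ k p → suc (k + p) * binom (k + p) p ≡ suc k * binom (suc (k + p)) p
binom-row-ratio k p = trans (sym (binom-absorb (k + p) p)) (binom-index-ratio (suc k) p refl)

binom-lower-bound : ∀ {x} k p → k + p ≡ x → suc (p * k) ≤ binom x p
binom-lower-bound       k       zero    _  = ≤-refl
binom-lower-bound       zero    (suc p) refl rewrite binom-diag (suc p) | *-zeroʳ p = ≤-refl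
binom-lower-bound {suc x} (suc k) (suc p) eq = begin
  suc (suc p * suc k)                         ≤⟨ m≤m+n _ (p * k) ⟩
  suc (suc p * suc k) + p * k                 ≡⟨ regroup p k ⟩
  suc (p * suc k) + suc (suc p * k)           ≤⟨ +-mono-≤ (binom-lower-bound (suc k) p sk+p≡x)
                                                          (binom-lower-bound k (suc p) k+sp≡x) ⟩
  binom x p + binom x (suc p)                 ∎
  where
  open ≤-Reasoning
  k+sp≡x : k + suc p ≡ x
  k+sp≡x = suc-injective eq
  sk+p≡x : suc k + p ≡ x
  sk+p≡x = trans (sym (+-suc k p)) k+sp≡x
  regroup : ∀ p k → suc (suc p * suc k) + p * k ≡ suc (p * suc k) + suc (suc p * k)
  regroup = solve-∀

-- s lies on or above F_p at every abscissa in [1, e]: the segment of F_p starting at x = k + p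
-- consists of the points (C(x, p + 1) + t, C(x, p) + p t / (k + 1)) with t ≤ C(x, p).
AboveChords : ℕ → ℕ → ℕ → Set
AboveChords p e s = ∀ x k t → k + p ≡ x → t ≤ binom x p →
  1 ≤ binom x (suc p) + t → binom x (suc p) + t ≤ e → suc k * binom x p + p * t ≤ suc k * s

aboveChords-mono : ∀ {p e s s′} → s ≤ s′ → AboveChords p e s → AboveChords p e s′
aboveChords-mono s≤s′ above x k t eq t≤ pos le =
  ≤-trans (above x k t eq t≤ pos le) (*-monoʳ-≤ (suc k) s≤s′)

aboveChords-empty : ∀ {p s} → AboveChords p 0 s
aboveChords-empty x k t eq t≤ pos le = ⊥-elim (1+n≰n (≤-trans pos le))

aboveChords-flat : ∀ {e s} → 1 ≤ s → AboveChords 0 e s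
aboveChords-flat 1≤s x k t eq t≤ pos le rewrite +-identityʳ (suc k * 1) = *-monoʳ-≤ (suc k) 1≤s

locate : ∀ p K {e} → e ≤ binom (suc (K + p)) (suc p) →
         ∃₂ λ k t → k ≤ K × t ≤ binom (k + p) p × binom (k + p) (suc p) + t ≡ e
locate p zero {e} e≤ = 0 , e , z≤n , ≤-trans e≤ (≤-reflexive c₁≡0) , cong (_+ e) (binom-over-diag p)
  where
  c₁≡0 : binom p p + binom p (suc p) ≡ binom p p
  c₁≡0 = trans (cong (binom p p +_) (binom-over-diag p)) (+-identityʳ _)
locate p (suc K) {e} e≤ with e ≤? binom (suc (K + p)) (suc p)
... | yes e≤′ = let k , t , k≤K , rest = locate p K e≤′ in k , t , m≤n⇒m≤1+n k≤K , rest
... | no  e≰  = suc K , e ∸ c₁ , ≤-refl , t≤ , m+[n∸m]≡n c₁≤e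
  where
  c₁ = binom (suc K + p) (suc p)
  c₁≤e : c₁ ≤ e
  c₁≤e = <⇒≤ (≰⇒> e≰)
  t≤ : e ∸ c₁ ≤ binom (suc K + p) p
  t≤ = ≤-trans (∸-monoˡ-≤ c₁ e≤)
         (≤-reflexive (trans (cong (_∸ c₁) (+-comm (binom (suc K + p) p) c₁)) (m+n∸m≡n c₁ _)))

-- By concavity, F_p lies above its chord from the origin to the vertex at x = K + p + 1.
aboveChords-slope : ∀ {p e s} → AboveChords p e s → ∀ K → e ≤ binom (suc (K + p)) (suc p) →
                    suc p * e ≤ suc K * s
aboveChords-slope {p} {zero}      _     K _  = ≤-trans (≤-reflexive (*-zeroʳ (suc p))) z≤n
aboveChords-slope {p} {e@(suc _)} {s} above K e≤ with locate p K e≤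
... | k , t , k≤K , t≤c , c₁+t≡e = begin
  suc p * e                   ≡⟨ cong (suc p *_) c₁+t≡e ⟨
  suc p * (c₁ + t)            ≡⟨ *-distribˡ-+ (suc p) c₁ t ⟩
  suc p * c₁ + suc p * t      ≡⟨ cong (_+ suc p * t) (binom-index-ratio k p refl) ⟩
  k * c₀ + suc p * t          ≡⟨ rearrange k c₀ p t ⟩
  k * c₀ + p * t + t          ≤⟨ +-monoʳ-≤ (k * c₀ + p * t) t≤c ⟩
  k * c₀ + p * t + c₀         ≡⟨ rearrange′ k c₀ p t ⟩
  suc k * c₀ + p * t          ≤⟨ above (k + p) k t refl t≤c (subst (1 ≤_) (sym c₁+t≡e) (s≤s z≤n))
                                       (≤-reflexive c₁+t≡e) ⟩
  suc k * s                   ≤⟨ *-monoˡ-≤ s (s≤s k≤K) ⟩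
  suc K * s                   ∎
  where
  open ≤-Reasoning
  c₀ = binom (k + p) p
  c₁ = binom (k + p) (suc p)
  rearrange : ∀ k c p t → k * c + suc p * t ≡ k * c + p * t + t
  rearrange = solve-∀
  rearrange′ : ∀ k c p t → k * c + p * t + c ≡ suc k * c + p * t
  rearrange′ = solve-∀

aboveChords-vertex : ∀ {p e s} → AboveChords p e s → 1 ≤ e → ∀ k → binom (k + p) (suc p) ≤ e →
                     binom (k + p) p ≤ s
-- At x = p the vertex (0, 1) lies outside [1, e], so the point (1, 1 + p) is used instead.
aboveChords-vertex {p} {s = s} above 1≤e zero _ = begin
  binom p p                ≤⟨ m≤m+n (binom p p) (p * 1) ⟩
  binom p p + p * 1        ≡⟨ cong (_+ p * 1) (+-identityʳ (binom p p)) ⟨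
  1 * binom p p + p * 1    ≤⟨ above p 0 1 refl (≤-reflexive (sym (binom-diag p))) (m≤n+m 1 _)
                                (≤-trans (≤-reflexive (cong (_+ 1) (binom-over-diag p))) 1≤e) ⟩
  1 * s                    ≡⟨ *-identityˡ s ⟩
  s                        ∎
  where open ≤-Reasoning
aboveChords-vertex {p} {s = s} above 1≤e (suc k) c₁≤e = *-cancelˡ-≤ (suc (suc k)) (begin
  suc (suc k) * c₀                ≡⟨ +-identityʳ _ ⟨
  suc (suc k) * c₀ + 0            ≡⟨ cong (suc (suc k) * c₀ +_) (*-zeroʳ p) ⟨
  suc (suc k) * c₀ + p * 0        ≤⟨ above (suc k + p) (suc k) 0 refl z≤n
                                       (≤-trans (binom-pos (s≤s (m≤n+m p k)))
                                                (≤-reflexive (sym (+-identityʳ _))))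
                                       (≤-trans (≤-reflexive (+-identityʳ _)) c₁≤e) ⟩
  suc (suc k) * s                 ∎)
  where
  open ≤-Reasoning
  c₀ = binom (suc k + p) p

suc-factor-≤ : ∀ K a b c u → suc K * u ≤ b → suc K * a + b ≤ suc K * c →
               suc (suc K) * a + (u + b) ≤ suc (suc K) * c
suc-factor-≤ K a b c u Ku≤b le = *-cancelˡ-≤ (suc K) (begin
  suc K * (suc (suc K) * a + (u + b))          ≡⟨ expand K a u b ⟩
  suc (suc K) * (suc K * a) + suc K * u + suc K * b
    ≤⟨ +-monoˡ-≤ (suc K * b) (+-monoʳ-≤ (suc (suc K) * (suc K * a)) Ku≤b) ⟩
  suc (suc K) * (suc K * a) + b + suc K * b    ≡⟨ collect K a b ⟩
  suc (suc K) * (suc K * a + b)                ≤⟨ *-monoʳ-≤ (suc (suc K)) le ⟩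
  suc (suc K) * (suc K * c)                    ≡⟨ swap (suc (suc K)) (suc K) c ⟩
  suc K * (suc (suc K) * c)                    ∎)
  where
  open ≤-Reasoning
  expand : ∀ K a u b → suc K * (suc (suc K) * a + (u + b)) ≡
                       suc (suc K) * (suc K * a) + suc K * u + suc K * b
  expand = solve-∀
  collect : ∀ K a b → suc (suc K) * (suc K * a) + b + suc K * b ≡ suc (suc K) * (suc K * a + b)
  collect = solve-∀
  swap : ∀ a b c → a * (b * c) ≡ b * (a * c)
  swap = solve-∀

-- F_{q+1}(l + m) ≤ F_q(l) + max(l, F_{q+1}(m)). By Pascal's rule the segment k of F_{q+1}
-- starts at (c₁ k + c₂ k, c₀ k + c₁ k).
module _ {q l m sL sR : ℕ} (aboveL : AboveChords q l sL) (aboveR : AboveChords (suc q) m sR) where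

  private
    c₀ c₁ c₂ : ℕ → ℕ
    c₀ k = binom (k + q) q
    c₁ k = binom (k + q) (suc q)
    c₂ k = binom (k + q) (suc (suc q))

    Bound : ℕ → ℕ → Set
    Bound k t = suc k * (c₀ k + c₁ k) + suc q * t ≤ suc k * (sL + (l ⊔ sR))

    join-link : ∀ K → K * (sL + l) ≤ K * (sL + (l ⊔ sR))
    join-link K = *-monoʳ-≤ K (+-monoʳ-≤ sL (m≤m⊔n l sR))

    join-deletion : ∀ K → K * (sL + sR) ≤ K * (sL + (l ⊔ sR))
    join-deletion K = *-monoʳ-≤ K (+-monoʳ-≤ sL (m≤n⊔m l sR))

    split-sum : ∀ K a b → K * a + K * b ≡ K * (b + a)
    split-sum K a b = trans (sym (*-distribˡ-+ K a b)) (cong (K *_) (+-comm a b))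

    bound-fits-deletion : ∀ k t → t ≤ c₀ k + c₁ k → 1 ≤ (c₁ k + c₂ k) + t → (c₁ k + c₂ k) + t ≤ m →
                      Bound k t
    bound-fits-deletion k t t≤ pos fits = begin
      suc k * (c₀ k + c₁ k) + suc q * t   ≤⟨ aboveR (suc (k + q)) k t (+-suc k q) t≤ pos fits ⟩
      suc k * sR                          ≤⟨ *-monoʳ-≤ (suc k) (m≤n+m sR sL) ⟩
      suc k * (sL + sR)                   ≤⟨ join-deletion (suc k) ⟩
      suc k * (sL + (l ⊔ sR))             ∎
      where open ≤-Reasoning

    bound-l<t : ∀ k o → 1 ≤ o → l + o ≤ c₀ k + c₁ k → (c₁ k + c₂ k) + (l + o) ≤ l + m →
                        Bound k (l + o)
    bound-l<t k o 1≤o t≤ le = begin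
      suc k * c + suc q * (l + o)            ≡⟨ rearrange (suc k) c (suc q) l o ⟩
      (suc k * c + suc q * o) + suc q * l    ≤⟨ +-mono-≤ onDeletion onLink ⟩
      suc k * sR + suc k * sL                ≡⟨ split-sum (suc k) sR sL ⟩
      suc k * (sL + sR)                      ≤⟨ join-deletion (suc k) ⟩
      suc k * (sL + (l ⊔ sR))                ∎
      where
      open ≤-Reasoning
      c = c₀ k + c₁ k
      rearrange : ∀ K c P l o → K * c + P * (l + o) ≡ (K * c + P * o) + P * l
      rearrange = solve-∀
      swap : ∀ a l o → l + (a + o) ≡ a + (l + o)
      swap = solve-∀
      onDeletion : suc k * c + suc q * o ≤ suc k * sR
      onDeletion = aboveR (suc (k + q)) k o (+-suc k q) (≤-trans (m≤n+m o l) t≤) (≤-trans 1≤o (m≤n+m o _))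
                 (+-cancelˡ-≤ l _ m (≤-trans (≤-reflexive (swap (c₁ k + c₂ k) l o)) le))
      onLink : suc q * l ≤ suc k * sL
      onLink = aboveChords-slope aboveL k (≤-trans (m≤m+n l o) t≤)

    bound-c≤l : ∀ k t → 1 ≤ l → t ≤ c₀ k + c₁ k → c₀ k + c₁ k ≤ l → Bound k t
    bound-c≤l k t 1≤l t≤c c≤l = begin
      suc k * c + suc q * t      ≤⟨ +-monoʳ-≤ (suc k * c) (*-monoʳ-≤ (suc q) t≤c) ⟩
      suc k * c + suc q * c      ≡⟨ cong (suc k * c +_) (binom-index-ratio (suc k) q refl) ⟩
      suc k * c + suc k * v      ≡⟨ split-sum (suc k) c v ⟩
      suc k * (v + c)            ≤⟨ *-monoʳ-≤ (suc k) (+-mono-≤ v≤sL c≤l) ⟩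
      suc k * (sL + l)           ≤⟨ join-link (suc k) ⟩
      suc k * (sL + (l ⊔ sR))    ∎
      where
      open ≤-Reasoning
      c = c₀ k + c₁ k
      v = binom (suc k + q) q
      v≤sL : v ≤ sL
      v≤sL = aboveChords-vertex aboveL 1≤l (suc k) c≤l

    bound-below : ∀ k t → 1 ≤ l → suc k * c₁ k + suc q * t ≤ suc k * l → Bound k t
    bound-below k t 1≤l below = begin
      suc k * (c₀ k + c₁ k) + suc q * t           ≡⟨ cong (_+ suc q * t) (*-distribˡ-+ (suc k) (c₀ k) _) ⟩
      (suc k * c₀ k + suc k * c₁ k) + suc q * t   ≡⟨ +-assoc (suc k * c₀ k) _ _ ⟩
      suc k * c₀ k + (suc k * c₁ k + suc q * t)   ≤⟨ +-mono-≤ (*-monoʳ-≤ (suc k) onLink) below ⟩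
      suc k * sL + suc k * l                      ≡⟨ *-distribˡ-+ (suc k) sL l ⟨
      suc k * (sL + l)                            ≤⟨ join-link (suc k) ⟩
      suc k * (sL + (l ⊔ sR))                     ∎
      where
      open ≤-Reasoning
      onLink : c₀ k ≤ sL
      onLink = aboveChords-vertex aboveL 1≤l k
                 (*-cancelˡ-≤ (suc k) (≤-trans (m≤m+n (suc k * c₁ k) (suc q * t)) below))

    bound-l≤c₁ : ∀ k t → 1 ≤ l → t ≤ l → l ≤ c₁ k → ¬ (suc k * c₁ k + suc q * t ≤ suc k * l) →
                 (c₁ k + c₂ k) + t ≤ l + m → Bound k t
    bound-l≤c₁ zero    t 1≤l _   l≤c₁ _      _  =
      ⊥-elim (1+n≰n (≤-trans 1≤l (≤-trans l≤c₁ (≤-reflexive (binom-over-diag q)))))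
    bound-l≤c₁ (suc k) t 1≤l t≤l l≤c₁ ¬below le with m≤n⇒∃[o]m+o≡n l≤c₁
    ... | j , l+j≡c₁ =
      ≤-trans (suc-factor-≤ k c (suc q * t) (sL + sR) 0 (≤-trans (≤-reflexive (*-zeroʳ (suc k))) z≤n)
                            onSegment)
              (join-deletion K)
      where
      open ≤-Reasoning
      K = suc (suc k)
      c = c₀ (suc k) + c₁ (suc k)
      c₁′ = c₁ (suc k)
      c₂′ = c₂ (suc k)
      rearrange : ∀ k q l j t → suc (suc k + q) * (l + j) + suc q * t ≡
                                (suc k * (l + j) + suc q * (j + t)) + suc q * l
      rearrange = solve-∀
      regroup : ∀ l j c t → l + (c + (j + t)) ≡ ((l + j) + c) + t
      regroup = solve-∀
      positive : ∀ j t → l + j ≡ c₁′ → ¬ (K * c₁′ + suc q * t ≤ K * l) → 1 ≤ j + t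
      positive (suc j) t       _      _      = s≤s z≤n
      positive zero    (suc t) _      _      = s≤s z≤n
      positive zero    zero    l+0≡c₁ ¬below = ⊥-elim (¬below (≤-reflexive (begin-equality
        K * c₁′ + suc q * 0   ≡⟨ cong (K * c₁′ +_) (*-zeroʳ (suc q)) ⟩
        K * c₁′ + 0           ≡⟨ +-identityʳ _ ⟩
        K * c₁′               ≡⟨ cong (K *_) l+0≡c₁ ⟨
        K * (l + 0)           ≡⟨ cong (K *_) (+-identityʳ l) ⟩
        K * l                 ∎)))
      onDeletion : suc k * c₁′ + suc q * (j + t) ≤ suc k * sR
      onDeletion = aboveR (suc k + q) k (j + t) (+-suc k q)
                 (≤-trans (+-monoʳ-≤ j t≤l) (≤-reflexive (trans (+-comm j l) l+j≡c₁)))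
                 (≤-trans (positive j t l+j≡c₁ ¬below) (m≤n+m (j + t) c₂′))
                 (+-cancelˡ-≤ l _ m (≤-trans (≤-reflexive (trans (regroup l j c₂′ t)
                   (cong (λ z → z + c₂′ + t) l+j≡c₁))) le))
      onLink : suc q * l ≤ suc k * sL
      onLink = aboveChords-slope aboveL k l≤c₁
      ratio : suc (suc k + q) * c₁′ ≡ suc k * c
      ratio = subst (λ n → suc n * binom n (suc q) ≡ suc k * binom (suc n) (suc q)) (+-suc k q)
                    (binom-row-ratio k (suc q))
      onSegment : suc k * c + suc q * t ≤ suc k * (sL + sR)
      onSegment = begin
        suc k * c + suc q * t
          ≡⟨ cong (_+ suc q * t) ratio ⟨
        suc (suc k + q) * c₁′ + suc q * t
          ≡⟨ cong (λ z → suc (suc k + q) * z + suc q * t) l+j≡c₁ ⟨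
        suc (suc k + q) * (l + j) + suc q * t
          ≡⟨ rearrange k q l j t ⟩
        (suc k * (l + j) + suc q * (j + t)) + suc q * l
          ≡⟨ cong (λ z → (suc k * z + suc q * (j + t)) + suc q * l) l+j≡c₁ ⟩
        (suc k * c₁′ + suc q * (j + t)) + suc q * l
          ≤⟨ +-mono-≤ onDeletion onLink ⟩
        suc k * sR + suc k * sL
          ≡⟨ split-sum (suc k) sR sL ⟩
        suc k * (sL + sR)
          ∎

    link-on-segment : ∀ k u → 1 ≤ l → c₁ k + u ≡ l → u ≤ c₀ k → suc k * c₀ k + q * u ≤ suc k * sL
    link-on-segment k u 1≤l c₁+u≡l u≤c₀ =
      aboveL (k + q) k u refl u≤c₀ (subst (1 ≤_) (sym c₁+u≡l) 1≤l) (≤-reflexive c₁+u≡l)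

    bound-c₁<l-small-t : ∀ k t u → 1 ≤ l → c₁ k + u ≡ l → u ≤ c₀ k → suc q * t ≤ (k + suc q) * u →
                         Bound k t
    bound-c₁<l-small-t k t u 1≤l c₁+u≡l u≤c₀ small = begin
      suc k * (c₀ k + c₁ k) + suc q * t                  ≤⟨ +-monoʳ-≤ (suc k * (c₀ k + c₁ k)) small ⟩
      suc k * (c₀ k + c₁ k) + (k + suc q) * u            ≡⟨ rearrange k q (c₀ k) (c₁ k) u ⟩
      (suc k * c₀ k + q * u) + suc k * (c₁ k + u)        ≤⟨ +-mono-≤ (link-on-segment k u 1≤l c₁+u≡l u≤c₀)
                                                                    (≤-reflexive (cong (suc k *_) c₁+u≡l)) ⟩
      suc k * sL + suc k * l                             ≡⟨ *-distribˡ-+ (suc k) sL l ⟨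
      suc k * (sL + l)                                   ≤⟨ join-link (suc k) ⟩
      suc k * (sL + (l ⊔ sR))                            ∎
      where
      open ≤-Reasoning
      rearrange : ∀ k q a b u → suc k * (a + b) + (k + suc q) * u ≡
                                (suc k * a + q * u) + suc k * (b + u)
      rearrange = solve-∀

    bound-c₁<l-large-t : ∀ k t u → 1 ≤ l → c₁ k + u ≡ l → u ≤ c₀ k → t ≤ l → t ≤ c₀ k + c₁ k →
                      (k + suc q) * u < suc q * t → (c₁ k + c₂ k) + t ≤ l + m → Bound k t
    bound-c₁<l-large-t zero t u 1≤l c₁+u≡l _ _ t≤c large _ = ⊥-elim (<⇒≱ large (begin
      suc q * t          ≤⟨ *-monoʳ-≤ (suc q) (≤-trans t≤c (≤-reflexive c₀+c₁≡1)) ⟩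
      suc q * 1          ≤⟨ *-monoʳ-≤ (suc q) (subst (1 ≤_) l≡u 1≤l) ⟩
      suc q * u          ∎))
      where
      open ≤-Reasoning
      c₀+c₁≡1 : binom q q + binom q (suc q) ≡ 1
      c₀+c₁≡1 = cong₂ _+_ (binom-diag q) (binom-over-diag q)
      l≡u : l ≡ u
      l≡u = trans (sym c₁+u≡l) (cong (_+ u) (binom-over-diag q))
    bound-c₁<l-large-t (suc k) t u 1≤l c₁+u≡l u≤c₀ t≤l _ large le with u ≤? t
    ... | no u≰t = ⊥-elim (<⇒≱ large (≤-trans (*-monoʳ-≤ (suc q) (<⇒≤ (≰⇒> u≰t)))
                                               (*-monoˡ-≤ u (m≤n+m (suc q) (suc k)))))
    ... | yes u≤t with m≤n⇒∃[o]m+o≡n u≤t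
    ...   | w , refl = ≤-trans (begin
      K * (c₀′ + c₁′) + suc q * (u + w)              ≡⟨ rearrange K q c₀′ c₁′ u w ⟩
      (K * c₀′ + q * u) + (K * c₁′ + (u + suc q * w)) ≤⟨ +-mono-≤ onLink onDeletion ⟩
      K * sL + K * sR                                 ≡⟨ *-distribˡ-+ K sL sR ⟨
      K * (sL + sR)                                   ∎) (join-deletion K)
      where
      open ≤-Reasoning
      K = suc (suc k)
      c₀′ = c₀ (suc k)
      c₁′ = c₁ (suc k)
      c₂′ = c₂ (suc k)
      rearrange : ∀ K q a b u w → K * (a + b) + suc q * (u + w) ≡
                                  (K * a + q * u) + (K * b + (u + suc q * w))
      rearrange = solve-∀
      positive : ∀ w → (suc k + suc q) * u < suc q * (u + w) → 1 ≤ w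
      positive (suc _) _    = s≤s z≤n
      positive zero    large = ⊥-elim (<⇒≱ large (≤-trans (≤-reflexive (cong (suc q *_) (+-identityʳ u)))
                                                         (*-monoˡ-≤ u (m≤n+m (suc q) (suc k)))))
      ku≤pw : suc k * u ≤ suc q * w
      ku≤pw = +-cancelˡ-≤ (suc q * u) _ _ (≤-trans (≤-reflexive (swap k q u))
                (≤-trans (<⇒≤ large) (≤-reflexive (*-distribˡ-+ (suc q) u w))))
        where
        swap : ∀ k q u → suc q * u + suc k * u ≡ (suc k + suc q) * u
        swap = solve-∀
      deletionOnSegment : suc k * c₁′ + suc q * w ≤ suc k * sR
      deletionOnSegment = aboveR (suc k + q) k w (+-suc k q)
        (+-cancelˡ-≤ u w c₁′ (≤-trans t≤l (≤-reflexive (trans (sym c₁+u≡l) (+-comm c₁′ u)))))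
        (≤-trans (positive w large) (m≤n+m w c₂′))
        (+-cancelˡ-≤ (c₁′ + u) _ m (≤-trans (≤-reflexive (regroup c₁′ u c₂′ w))
          (≤-trans le (≤-reflexive (cong (_+ m) (sym c₁+u≡l))))))
        where
        regroup : ∀ a u b w → (a + u) + (b + w) ≡ (a + b) + (u + w)
        regroup = solve-∀
      onLink : K * c₀′ + q * u ≤ K * sL
      onLink = link-on-segment (suc k) u 1≤l c₁+u≡l u≤c₀
      onDeletion : K * c₁′ + (u + suc q * w) ≤ K * sR
      onDeletion = suc-factor-≤ k c₁′ (suc q * w) sR u ku≤pw deletionOnSegment

    bound-c₁<l : ∀ k t u → 1 ≤ l → t ≤ l → t ≤ c₀ k + c₁ k → c₁ k + u ≡ l → u ≤ c₀ k →
                 (c₁ k + c₂ k) + t ≤ l + m → Bound k t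
    bound-c₁<l k t u 1≤l t≤l t≤c c₁+u≡l u≤c₀ le with suc q * t ≤? (k + suc q) * u
    ... | yes small = bound-c₁<l-small-t k t u 1≤l c₁+u≡l u≤c₀ small
    ... | no  large = bound-c₁<l-large-t k t u 1≤l c₁+u≡l u≤c₀ t≤l t≤c (≰⇒> large) le

    bound-t≤l : ∀ k t → 1 ≤ l → t ≤ l → t ≤ c₀ k + c₁ k → (c₁ k + c₂ k) + t ≤ l + m → Bound k t
    bound-t≤l k t 1≤l t≤l t≤c le with c₀ k + c₁ k ≤? l
    ... | yes c≤l = bound-c≤l k t 1≤l t≤c c≤l
    ... | no  c≰l with suc k * c₁ k + suc q * t ≤? suc k * l
    ...   | yes below  = bound-below k t 1≤l below
    ...   | no  ¬below with l ≤? c₁ k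
    ...     | yes l≤c₁ = bound-l≤c₁ k t 1≤l t≤l l≤c₁ ¬below le
    ...     | no  l≰c₁ with m≤n⇒∃[o]m+o≡n (<⇒≤ (≰⇒> l≰c₁))
    ...       | u , c₁+u≡l = bound-c₁<l k t u 1≤l t≤l t≤c c₁+u≡l u≤c₀ le
      where
      u≤c₀ : u ≤ c₀ k
      u≤c₀ = <⇒≤ (+-cancelˡ-< (c₁ k) u (c₀ k)
                   (subst₂ _<_ (sym c₁+u≡l) (+-comm (c₀ k) (c₁ k)) (≰⇒> c≰l)))

    bound-overflow : ∀ k t → 1 ≤ l → t ≤ c₀ k + c₁ k → (c₁ k + c₂ k) + t ≤ l + m → Bound k t
    bound-overflow k t 1≤l t≤c le with t ≤? l
    ... | yes t≤l = bound-t≤l k t 1≤l t≤l t≤c le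
    ... | no  t≰l with m≤n⇒∃[o]m+o≡n (<⇒≤ (≰⇒> t≰l))
    ...   | o , refl = bound-l<t k o 1≤o t≤c le
      where
      1≤o : 1 ≤ o
      1≤o = +-cancelˡ-< l 0 o (subst (_< l + o) (sym (+-identityʳ l)) (≰⇒> t≰l))

    bound : ∀ k t → t ≤ c₀ k + c₁ k → 1 ≤ (c₁ k + c₂ k) + t → (c₁ k + c₂ k) + t ≤ l + m → Bound k t
    bound k t t≤c pos le with (c₁ k + c₂ k) + t ≤? m
    ... | yes fits     = bound-fits-deletion k t t≤c pos fits
    ... | no  overflow = bound-overflow k t (+-cancelʳ-< m 0 l (<-≤-trans (≰⇒> overflow) le)) t≤c le

  aboveChords-split : AboveChords (suc q) (l + m) (sL + (l ⊔ sR))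
  aboveChords-split zero    k t eq = ⊥-elim (1+n≢0 (trans (sym (+-suc k q)) eq))
  aboveChords-split (suc x) k t eq with suc-injective (trans (sym (+-suc k q)) eq)
  ... | refl = bound k t

count : ∀ n {P : Subset n → Set} → Decidable P → ℕ
count zero    P? = if does (P? []) then 1 else 0
count (suc n) P? = count n (λ S → P? (outside ∷ S)) + count n (λ S → P? (inside ∷ S))

length-filter-map : ∀ {A B : Set} {P : B → Set} (P? : Decidable P) (f : A → B) (xs : List A) →
                    length (filter P? (map f xs)) ≡ length (filter (λ x → P? (f x)) xs)
length-filter-map P? f []       = refl
length-filter-map P? f (x ∷ xs) with does (P? (f x))
... | true  = cong suc (length-filter-map P? f xs)
... | false = length-filter-map P? f xs

length-filter-allSubsets : ∀ n {P : Subset n → Set} (P? : Decidable P) →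
                           length (filter P? (allSubsets n)) ≡ count n P?
length-filter-allSubsets zero    P? with does (P? [])
... | true  = refl
... | false = refl
length-filter-allSubsets (suc n) P? = begin
  length (filter P? (map (outside ∷_) Ss ++ map (inside ∷_) Ss))
    ≡⟨ cong length (filter-++ P? (map (outside ∷_) Ss) (map (inside ∷_) Ss)) ⟩
  length (filter P? (map (outside ∷_) Ss) ++ filter P? (map (inside ∷_) Ss))
    ≡⟨ length-++ (filter P? (map (outside ∷_) Ss)) ⟩
  length (filter P? (map (outside ∷_) Ss)) + length (filter P? (map (inside ∷_) Ss))
    ≡⟨ cong₂ _+_ (trans (length-filter-map P? (outside ∷_) Ss) (length-filter-allSubsets n _))
                 (trans (length-filter-map P? (inside ∷_) Ss) (length-filter-allSubsets n _)) ⟩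
  count (suc n) P?
    ∎
  where
  open ≡-Reasoning
  Ss = allSubsets n

count-mono : ∀ n {P Q : Subset n → Set} (P? : Decidable P) (Q? : Decidable Q) →
             (∀ {S} → P S → Q S) → count n P? ≤ count n Q?
count-mono zero    P? Q? P⇒Q with P? [] | Q? []
... | yes _ | yes _  = ≤-refl
... | yes p | no ¬q  = ⊥-elim (¬q (P⇒Q p))
... | no _  | _      = z≤n
count-mono (suc n) P? Q? P⇒Q = +-mono-≤ (count-mono n _ _ P⇒Q) (count-mono n _ _ P⇒Q)

count-pos : ∀ n {P : Subset n → Set} (P? : Decidable P) {S} → P S → 1 ≤ count n P?
count-pos zero    P? {[]} p with P? []
... | yes _ = ≤-refl
... | no ¬p = ⊥-elim (¬p p)
count-pos (suc n) P? {outside ∷ S} p = ≤-trans (count-pos n _ p) (m≤m+n _ _)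
count-pos (suc n) P? {inside  ∷ S} p = ≤-trans (count-pos n _ p) (m≤n+m _ _)

link : ∀ {n} → List (Subset (suc n)) → List (Subset n)
link []                   = []
link ((outside ∷ E) ∷ Es) = link Es
link ((inside  ∷ E) ∷ Es) = E ∷ link Es

deletion : ∀ {n} → List (Subset (suc n)) → List (Subset n)
deletion []                   = []
deletion ((outside ∷ E) ∷ Es) = E ∷ deletion Es
deletion ((inside  ∷ E) ∷ Es) = deletion Es

length-link+deletion : ∀ {n} (Es : List (Subset (suc n))) →
                       length Es ≡ length (link Es) + length (deletion Es)
length-link+deletion []                   = refl
length-link+deletion ((outside ∷ E) ∷ Es) = trans (cong suc (length-link+deletion Es)) (sym (+-suc _ _))
length-link+deletion ((inside  ∷ E) ∷ Es) = cong suc (length-link+deletion Es)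

module _ {n} {P : Subset (suc n) → Set} where

  all-link : ∀ {Es} → All P Es → All (λ E → P (inside ∷ E)) (link Es)
  all-link {[]}                 []       = []
  all-link {(outside ∷ E) ∷ Es} (_ ∷ ps) = all-link ps
  all-link {(inside  ∷ E) ∷ Es} (p ∷ ps) = p ∷ all-link ps

  all-deletion : ∀ {Es} → All P Es → All (λ E → P (outside ∷ E)) (deletion Es)
  all-deletion {[]}                 []       = []
  all-deletion {(outside ∷ E) ∷ Es} (p ∷ ps) = p ∷ all-deletion ps
  all-deletion {(inside  ∷ E) ∷ Es} (_ ∷ ps) = all-deletion ps

unique-link : ∀ {n} {Es : List (Subset (suc n))} → Unique Es → Unique (link Es)
unique-link {Es = []}                 _        = []
unique-link {Es = (outside ∷ E) ∷ Es} (_ ∷ u)  = unique-link u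
unique-link {Es = (inside  ∷ E) ∷ Es} (h ∷ u)  =
  All.map (λ ne eq → ne (cong (inside ∷_) eq)) (all-link h) ∷ unique-link u

unique-deletion : ∀ {n} {Es : List (Subset (suc n))} → Unique Es → Unique (deletion Es)
unique-deletion {Es = []}                 _        = []
unique-deletion {Es = (outside ∷ E) ∷ Es} (h ∷ u)  =
  All.map (λ ne eq → ne (cong (outside ∷_) eq)) (all-deletion h) ∷ unique-deletion u
unique-deletion {Es = (inside  ∷ E) ∷ Es} (_ ∷ u)  = unique-deletion u

∷⊆inside∷ : ∀ b {n} {S T : Subset n} → S ⊆ T → b ∷ S ⊆ inside ∷ T
∷⊆inside∷ inside  = in⊆in
∷⊆inside∷ outside = out⊆

any⊆-link : ∀ b {n} {S : Subset n} (Es : List (Subset (suc n))) →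
            Any (S ⊆_) (link Es) → Any ((b ∷ S) ⊆_) Es
any⊆-link b ((outside ∷ E) ∷ Es) S⊆         = there (any⊆-link b Es S⊆)
any⊆-link b ((inside  ∷ E) ∷ Es) (here S⊆E) = here (∷⊆inside∷ b S⊆E)
any⊆-link b ((inside  ∷ E) ∷ Es) (there S⊆) = there (any⊆-link b Es S⊆)

any⊆-deletion : ∀ {n} {S : Subset n} (Es : List (Subset (suc n))) →
                Any (S ⊆_) (deletion Es) → Any ((outside ∷ S) ⊆_) Es
any⊆-deletion ((inside  ∷ E) ∷ Es) S⊆         = there (any⊆-deletion Es S⊆)
any⊆-deletion ((outside ∷ E) ∷ Es) (here S⊆E) = here (out⊆ S⊆E)
any⊆-deletion ((outside ∷ E) ∷ Es) (there S⊆) = there (any⊆-deletion Es S⊆)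

length≤count : ∀ n {P : Subset n → Set} (P? : Decidable P) {xs : List (Subset n)} →
               Unique xs → All P xs → length xs ≤ count n P?
length≤count zero    P? {[]}          _                _       = z≤n
length≤count zero    P? {[] ∷ []}     _                (p ∷ _) = count-pos zero P? p
length≤count zero    P? {[] ∷ [] ∷ _} ((ne ∷ _) ∷ _)   _       = ⊥-elim (ne refl)
length≤count (suc n) P? {xs} u ps = begin
  length xs                                 ≡⟨ length-link+deletion xs ⟩
  length (link xs) + length (deletion xs)   ≡⟨ +-comm (length (link xs)) _ ⟩
  length (deletion xs) + length (link xs)   ≤⟨ +-mono-≤ (length≤count n _ (unique-deletion u) (all-deletion ps))
                                                        (length≤count n _ (unique-link u) (all-link ps)) ⟩
  count (suc n) P?                          ∎
  where open ≤-Reasoning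

shadowCount : ∀ {n} → ℕ → List (Subset n) → ℕ
shadowCount {n} m Es = count n (λ S → (∣ S ∣ ≟ m) ×-dec Any.any? (S ⊆?_) Es)

shadowCount-link-deletion : ∀ {n} q (Es : List (Subset (suc n))) →
  Unique Es → All (λ E → ∣ E ∣ ≡ suc (suc q)) Es →
  shadowCount q (link Es) + (length (link Es) ⊔ shadowCount (suc q) (deletion Es)) ≤
  shadowCount (suc q) Es
shadowCount-link-deletion {n} q Es u ps =
  ≤-trans (≤-reflexive (+-comm (shadowCount q (link Es)) _))
          (+-mono-≤ (⊔-lub linkEdges deletionShadow) linkShadow)
  where
  linkShadow : shadowCount q (link Es) ≤ count n _
  linkShadow = count-mono n _ _ (λ (∣S∣≡ , S⊆) → cong suc ∣S∣≡ , any⊆-link inside Es S⊆)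
  deletionShadow : shadowCount (suc q) (deletion Es) ≤ count n _
  deletionShadow = count-mono n _ _ (λ (∣S∣≡ , S⊆) → ∣S∣≡ , any⊆-deletion Es S⊆)
  linkEdges : length (link Es) ≤ count n _
  linkEdges = length≤count n _ (unique-link u)
    (All.zip (All.map suc-injective (all-link ps) ,
              All.map (any⊆-link outside Es) (All.tabulate (Any.map ⊆-reflexive))))

shadow-aboveChords : ∀ p {n} (Es : List (Subset n)) → Unique Es → All (λ E → ∣ E ∣ ≡ suc p) Es →
                     AboveChords p (length Es) (shadowCount p Es)
shadow-aboveChords p       []       _ _        = aboveChords-empty
shadow-aboveChords p       {zero}  ([] ∷ _) _ (() ∷ _)
shadow-aboveChords zero    {suc n} (E ∷ Es) _ _ =
  aboveChords-flat (count-pos (suc n) (λ S → (∣ S ∣ ≟ 0) ×-dec Any.any? (S ⊆?_) (E ∷ Es)) {⊥}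
                     (∣⊥∣≡0 (suc n) , here ⊥⊆))
shadow-aboveChords (suc q) {suc n} Es@(_ ∷ _) u ps =
  aboveChords-mono (shadowCount-link-deletion q Es u ps)
    (subst (λ e → AboveChords (suc q) e (shadowCount q L + (length L ⊔ shadowCount (suc q) R)))
           (sym (length-link+deletion Es))
           (aboveChords-split aboveL aboveR))
  where
  L = link Es
  R = deletion Es
  aboveL : AboveChords q (length L) (shadowCount q L)
  aboveL = shadow-aboveChords q L (unique-link u) (All.map suc-injective (all-link ps))
  aboveR : AboveChords (suc q) (length R) (shadowCount (suc q) R)
  aboveR = shadow-aboveChords (suc q) R (unique-deletion u) (all-deletion ps)

shadowSize≡shadowCount : ∀ {r} m (G : Hypergraph r) → shadowSize m G ≡ shadowCount m (edges G)
shadowSize≡shadowCount m G = length-filter-allSubsets (n G) _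

affine-≤-endpoints : ∀ {A B C D T t} → A ≤ C → A + B * T ≤ C + D * T → t ≤ T → A + B * t ≤ C + D * t
affine-≤-endpoints {A} {B} {C} {D} {T} {t} A≤C end t≤T with B ≤? D
... | yes B≤D = +-mono-≤ A≤C (*-monoˡ-≤ t B≤D)
... | no  B≰D with m≤n⇒∃[o]m+o≡n (<⇒≤ (≰⇒> B≰D))
...   | b , refl = begin
  A + (D + b) * t       ≡⟨ rearrange A D b t ⟩
  (A + b * t) + D * t   ≤⟨ +-monoˡ-≤ (D * t) (≤-trans (+-monoʳ-≤ A (*-monoʳ-≤ b t≤T)) A+bT≤C) ⟩
  C + D * t             ∎
  where
  open ≤-Reasoning
  rearrange : ∀ A D b t → A + (D + b) * t ≡ (A + b * t) + D * t
  rearrange = solve-∀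
  A+bT≤C : A + b * T ≤ C
  A+bT≤C = +-cancelʳ-≤ (D * T) _ _ (≤-trans (≤-reflexive (sym (rearrange A D b T))) end)

vertex-value : ∀ p j i {a} → a ≤ p * (suc j + i) + 1 → a ≤ suc i * suc (p * suc j)
vertex-value p j i a≤ = ≤-trans a≤ (≤-trans (m≤m+n _ (i + p * i * j)) (≤-reflexive (expand p j i)))
  where
  expand : ∀ p j i → p * (suc j + i) + 1 + (i + p * i * j) ≡ suc i * suc (p * suc j)
  expand = solve-∀

bound-first-segment : ∀ {p d s a} → AboveChords p 1 s → a ≤ p * suc d + 1 →
                      a + suc p * 1 ≤ suc (suc d) * s
bound-first-segment {p} {d} {s} {a} above a≤ = begin
  a + suc p * 1                    ≤⟨ +-monoˡ-≤ (suc p * 1) a≤[d+1]r ⟩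
  suc d * (suc p * 1) + suc p * 1  ≡⟨ +-comm (suc d * (suc p * 1)) _ ⟩
  suc (suc d) * (suc p * 1)        ≤⟨ *-monoʳ-≤ (suc (suc d)) (≤-trans slope (≤-reflexive (*-identityˡ s))) ⟩
  suc (suc d) * s                  ∎
  where
  open ≤-Reasoning
  expand : ∀ p d → p * suc d + 1 + d ≡ suc d * (suc p * 1)
  expand = solve-∀
  a≤[d+1]r : a ≤ suc d * (suc p * 1)
  a≤[d+1]r = ≤-trans a≤ (≤-trans (m≤m+n _ d) (≤-reflexive (expand p d)))
  slope : suc p * 1 ≤ 1 * s
  slope = aboveChords-slope above 0 (≤-reflexive (sym (binom-diag (suc p))))

bound-last-segment : ∀ {p d s a} t → AboveChords p (binom (suc d + p) (suc p) + t) s →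
                     t + a ≤ binom (suc d + p) p →
                     a + suc p * (binom (suc d + p) (suc p) + t) ≤ suc (suc d) * s
bound-last-segment {p} {d} {s} {a} t above t+a≤c₀ = begin
  a + suc p * (c₁ + t)              ≡⟨ cong (a +_) (*-distribˡ-+ (suc p) c₁ t) ⟩
  a + (suc p * c₁ + suc p * t)      ≡⟨ cong (λ z → a + (z + suc p * t)) (binom-index-ratio (suc d) p refl) ⟩
  a + (suc d * c₀ + suc p * t)      ≡⟨ rearrange a d p c₀ t ⟩
  (t + a) + (suc d * c₀ + p * t)    ≤⟨ +-monoˡ-≤ (suc d * c₀ + p * t) t+a≤c₀ ⟩
  c₀ + (suc d * c₀ + p * t)         ≡⟨ +-assoc c₀ (suc d * c₀) (p * t) ⟨
  suc (suc d) * c₀ + p * t          ≤⟨ above (suc d + p) (suc d) t refl (m+n≤o⇒m≤o t t+a≤c₀)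
                                         (≤-trans (binom-pos (s≤s (m≤n+m p d))) (m≤m+n c₁ t)) ≤-refl ⟩
  suc (suc d) * s                   ∎
  where
  open ≤-Reasoning
  c₀ = binom (suc d + p) p
  c₁ = binom (suc d + p) (suc p)
  rearrange : ∀ a d p c t → a + (suc d * c + suc p * t) ≡ (t + a) + (suc d * c + p * t)
  rearrange = solve-∀

bound-inner-segment : ∀ {p s a} k i t → AboveChords p (binom (suc k + p) (suc p) + t) s →
                      t ≤ binom (suc k + p) p → a ≤ p * suc (suc k + i) + 1 →
                      a + suc p * (binom (suc k + p) (suc p) + t) ≤ suc (suc (suc k + i)) * s
bound-inner-segment {p} {s} {a} k i t above t≤c₀ a≤ = *-cancelˡ-≤ K (begin
  K * (a + suc p * (c₁ + t))             ≡⟨ cong (λ z → K * (a + z)) (*-distribˡ-+ (suc p) c₁ t) ⟩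
  K * (a + (suc p * c₁ + suc p * t))
    ≡⟨ cong (λ z → K * (a + (z + suc p * t))) (binom-index-ratio (suc k) p refl) ⟩
  K * (a + (suc k * c₀ + suc p * t))     ≡⟨ expand₁ K a (suc k * c₀) (suc p) t ⟩
  K * (a + suc k * c₀) + K * suc p * t   ≤⟨ affine-≤-endpoints {B = K * suc p} {D = δ * p} left right t≤c₀ ⟩
  δ * (K * c₀) + δ * p * t               ≡⟨ factor δ (K * c₀) p t ⟩
  δ * (K * c₀ + p * t)                   ≤⟨ *-monoʳ-≤ δ onChord ⟩
  δ * (K * s)                            ≡⟨ swap δ K s ⟩
  K * (δ * s)                            ∎)
  where
  open ≤-Reasoning
  K = suc (suc k)
  δ = suc (suc (suc k + i))
  c₀ = binom (suc k + p) p
  c₁ = binom (suc k + p) (suc p)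
  c₀′ = binom (suc (suc k + p)) p
  expand₁ : ∀ K a b P t → K * (a + (b + P * t)) ≡ K * (a + b) + K * P * t
  expand₁ = solve-∀
  factor : ∀ δ x p t → δ * x + δ * p * t ≡ δ * (x + p * t)
  factor = solve-∀
  swap : ∀ a b c → a * (b * c) ≡ b * (a * c)
  swap = solve-∀
  onChord : K * c₀ + p * t ≤ K * s
  onChord = above (suc k + p) (suc k) t refl t≤c₀
              (≤-trans (binom-pos (s≤s (m≤n+m p k))) (m≤m+n _ t)) ≤-refl
  left : K * (a + suc k * c₀) ≤ δ * (K * c₀)
  left = begin
    K * (a + suc k * c₀)                 ≤⟨ *-monoʳ-≤ K (+-monoˡ-≤ (suc k * c₀) a≤vertex) ⟩
    K * (suc (suc i) * c₀ + suc k * c₀)  ≡⟨ collect k i c₀ ⟩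
    δ * (K * c₀)                         ∎
    where
    a≤vertex : a ≤ suc (suc i) * c₀
    a≤vertex = ≤-trans (vertex-value p k (suc i) (subst (λ z → a ≤ p * z + 1) (sym (+-suc (suc k) i)) a≤))
                       (*-monoʳ-≤ (suc (suc i)) (binom-lower-bound (suc k) p refl))
    collect : ∀ k i c → suc (suc k) * (suc (suc i) * c + suc k * c) ≡
                        suc (suc (suc k + i)) * (suc (suc k) * c)
    collect = solve-∀
  right : K * (a + suc k * c₀) + K * suc p * c₀ ≤ δ * (K * c₀) + δ * p * c₀
  right = begin
    K * (a + suc k * c₀) + K * suc p * c₀  ≡⟨ merge k p a c₀ ⟩
    K * (a + suc (suc k + p) * c₀)         ≡⟨ cong (λ z → K * (a + z)) (binom-row-ratio (suc k) p) ⟩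
    K * (a + K * c₀′)                      ≤⟨ *-monoʳ-≤ K (+-monoˡ-≤ (K * c₀′) a≤vertex) ⟩
    K * (suc i * c₀′ + K * c₀′)            ≡⟨ collect k i c₀′ ⟩
    δ * (K * c₀′)                          ≡⟨ cong (δ *_) (binom-row-ratio (suc k) p) ⟨
    δ * (suc (suc k + p) * c₀)             ≡⟨ split k i p c₀ ⟩
    δ * (K * c₀) + δ * p * c₀              ∎
    where
    a≤vertex : a ≤ suc i * c₀′
    a≤vertex = ≤-trans (vertex-value p (suc k) i a≤)
                       (*-monoʳ-≤ (suc i) (binom-lower-bound (suc (suc k)) p refl))
    merge : ∀ k p a c → suc (suc k) * (a + suc k * c) + suc (suc k) * suc p * c ≡
                        suc (suc k) * (a + suc (suc k + p) * c)
    merge = solve-∀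
    collect : ∀ k i c → suc (suc k) * (suc i * c + suc (suc k) * c) ≡
                        suc (suc (suc k + i)) * (suc (suc k) * c)
    collect = solve-∀
    split : ∀ k i p c → suc (suc (suc k + i)) * (suc (suc k + p) * c) ≡
                        suc (suc (suc k + i)) * (suc (suc k) * c) + suc (suc (suc k + i)) * p * c
    split = solve-∀

bound-below-last-segment : ∀ {p d s a} k t → k ≤ d → AboveChords p (binom (k + p) (suc p) + t) s →
                           1 ≤ binom (k + p) (suc p) + t → t ≤ binom (k + p) p → a ≤ p * suc d + 1 →
                           a + suc p * (binom (k + p) (suc p) + t) ≤ suc (suc d) * s
bound-below-last-segment {p} {d} {s} {a} zero t _ above 1≤e t≤c₀ a≤ =
  subst (λ e → a + suc p * e ≤ suc (suc d) * s) (sym e≡1)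
        (bound-first-segment (subst (λ e → AboveChords p e s) e≡1 above) a≤)
  where
  e≤1 : binom p (suc p) + t ≤ 1
  e≤1 = ≤-trans (+-mono-≤ (≤-reflexive (binom-over-diag p)) t≤c₀) (≤-reflexive (binom-diag p))
  e≡1 : binom p (suc p) + t ≡ 1
  e≡1 = ≤-antisym e≤1 1≤e
bound-below-last-segment (suc k) t k<d above _ t≤c₀ a≤ with m≤n⇒∃[o]m+o≡n k<d
... | i , refl = bound-inner-segment k i t above t≤c₀ a≤

aboveChords⇒deficiency : ∀ {p d e s a} → AboveChords p e s → 1 ≤ e → a ≤ p * suc d + 1 →
                         e + a ≤ binom (suc (suc d + p)) (suc p) → a + suc p * e ≤ suc (suc d) * s
aboveChords⇒deficiency {p} {d} {e} {a = a} above 1≤e a≤ e+a≤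
  with locate p (suc d) {e} (m+n≤o⇒m≤o e e+a≤)
... | k , t , k≤ , t≤c₀ , refl with m≤n⇒m<n∨m≡n k≤
...   | inj₁ (s≤s k≤d) = bound-below-last-segment k t k≤d above 1≤e t≤c₀ a≤
...   | inj₂ refl      = bound-last-segment t above
  (+-cancelˡ-≤ c₁ (t + a) _ (≤-trans (≤-reflexive (sym (+-assoc c₁ t a)))
                                     (≤-trans e+a≤ (≤-reflexive (+-comm (binom (suc d + p) p) c₁)))))
  where
  c₁ = binom (suc d + p) (suc p)

-- Imported only here: the prefix +_ of ℤ would make the sections (x +_) above ambiguous.
open import Data.Integer using (+_; _-_; +≤+) renaming (_≤_ to _≤ℤ_)
open import Data.Integer.Properties using ([+m]-[+n]≡m⊖n; ⊖-≥)

+≤+-∸ : ∀ {a x y} → a + y ≤ x → + a ≤ℤ + x - + y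
+≤+-∸ {a} {x} {y} a+y≤x rewrite [+m]-[+n]≡m⊖n x y | ⊖-≥ (m+n≤o⇒n≤o a a+y≤x) =
  +≤+ (m+n≤o⇒m≤o∸n a a+y≤x)

proposition6p4 : (r δ e a : ℕ) → 1 ≤ r → 2 ≤ δ → 1 ≤ e → 1 ≤ a →
    (G : Hypergraph r) → numEdges G ≡ e →
    a ≤ (r ∸ 1) * (δ ∸ 1) + 1 →
    e + a ≤ (r + δ ∸ 1) C r →
    (+ a) ≤ℤ f r δ G
proposition6p4 (suc p) (suc (suc d)) _ a (s≤s _) (s≤s (s≤s _)) 1≤e _ G refl a≤ e+a≤ =
  +≤+-∸ (subst (λ s → a + suc p * numEdges G ≤ suc (suc d) * s)
               (sym (shadowSize≡shadowCount p G))
               (aboveChords⇒deficiency above 1≤e a≤ (subst (numEdges G + a ≤_) (sym binom≡[r+δ∸1]Cr) e+a≤)))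
  where
  above : AboveChords p (numEdges G) (shadowCount p (edges G))
  above = shadow-aboveChords p (edges G) (unique G) (uniform G)
  binom≡[r+δ∸1]Cr : binom (suc (suc d + p)) (suc p) ≡ (p + suc (suc d)) C suc p
  binom≡[r+δ∸1]Cr = trans (cong (λ x → binom x (suc p)) (+-comm (suc (suc d)) p))
                          (binom≡C (p + suc (suc d)) (suc p))
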